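{- Let $G$ be a connected graph and $H$ a connected subgraph of $G$ with at least two vertices. Suppose $v\in\partial H$ and $u$ is a witness for $v\in\partial H$. If $N_H(v)=N_G(v)$ and $d_H(v,u)=2$, then $v\in\partial G$.
   Context: Graphs are finite, simple, undirected; $d_K$, $N_K$, $\deg_K$ denote distance, neighbourhood and degree in a graph $K$. For a connected graph $K=(V,E)$, the Steinerberger boundary is $\partial K=\{v\in V:\ \exists u\in V \text{ with } \frac{1}{\deg_K(v)}\sum_{w\in N_K(v)} d_K(w,u)<d_K(v,u)\}$ (with $\partial K=V$ if $|V|=1$); any such $u$ is called a witness for $v\in\partial K$. -}

module Defs where

open import Data.Nat using (ℕ; zero; suc; _+_; _*_; _<_)
open import Data.Fin using (Fin; _≟_)
open import Data.Bool using (Bool; true; false; if_then_else_; _∨_; _∧_)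
open import Data.List using (List; map; allFin; filter; length)
open import Data.Nat.ListAction using (sum)
open import Data.Bool.ListAction using (any)
open import Data.Product using (Σ; ∃; _×_; _,_)
open import Data.Sum using (_⊎_)
open import Relation.Nullary.Decidable using (⌊_⌋)
open import Relation.Binary.PropositionalEquality using (_≡_)
open import Function using (_⇔_)

record Graph : Set where
  field
    n      : ℕ
    adj    : Fin n → Fin n → Bool
    sym    : ∀ x y → adj x y ≡ adj y x
    irrefl : ∀ x → adj x x ≡ false

open Graph public

Vertex : Graph → Set
Vertex K = Fin (n K)

Adj : (K : Graph) → Vertex K → Vertex K → Set
Adj K x y = adj K x y ≡ true

data Walk (K : Graph) : Vertex K → Vertex K → ℕ → Set where
  here : ∀ {x} → Walk K x x 0
  step : ∀ {x y z k} → Adj K x y → Walk K y z k → Walk K x z (suc k)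

Connected : Graph → Set
Connected K = ∀ (x y : Vertex K) → ∃ λ k → Walk K x y k

reachWithin : (K : Graph) → ℕ → Vertex K → Vertex K → Bool
reachWithin K zero    x y = ⌊ x ≟ y ⌋
reachWithin K (suc k) x y =
  reachWithin K k x y ∨ any (λ w → adj K x w ∧ reachWithin K k w y) (allFin (n K))

-- Graph distance d_K(x,y): the least k with a walk of length k from x to y
-- (searched over k = 0 .. n-1; for a disconnected pair the value n is returned,
-- which is never used since all graphs below are connected).
dist : (K : Graph) → Vertex K → Vertex K → ℕ
dist K x y = go (n K) 0
  where
  go : ℕ → ℕ → ℕ
  go zero    k = k
  go (suc f) k = if reachWithin K k x y then k else go f (suc k)

deg : (K : Graph) → Vertex K → ℕ
deg K v = length (filter (λ w → adj K v w ≟ᵇ true) (allFin (n K)))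
  where
  open import Data.Bool.Properties using () renaming (_≟_ to _≟ᵇ_)

nbrDistSum : (K : Graph) → Vertex K → Vertex K → ℕ
nbrDistSum K v u = sum (map (λ w → if adj K v w then dist K w u else 0) (allFin (n K)))

-- u is a witness for v ∈ ∂K:  (1/deg v) Σ_{w∈N(v)} d(w,u) < d(v,u),
-- written with the (positive) denominator cleared; when deg v = 0 this is
-- false, matching that the average is undefined (such v only occur if |V| = 1).
Witness : (K : Graph) → Vertex K → Vertex K → Set
Witness K v u = (0 < deg K v) × (nbrDistSum K v u < deg K v * dist K v u)

InBoundary : (K : Graph) → Vertex K → Set
InBoundary K v = (n K ≡ 1) ⊎ (∃ λ u → Witness K v u)

IsSubgraph : (H G : Graph) → (Vertex H → Vertex G) → Set
IsSubgraph H G f =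
  (∀ a b → f a ≡ f b → a ≡ b) × (∀ a b → Adj H a b → Adj G (f a) (f b))

SameNbhd : (H G : Graph) → (Vertex H → Vertex G) → Vertex H → Set
SameNbhd H G f v = ∀ (x : Vertex G) → Adj G (f v) x ⇔ (∃ λ a → (f a ≡ x) × Adj H v a)

-- The
-- neighbourhood of v is the same in G, so the degree does not change; walks of
-- H are walks of G, so the distance from each neighbour to u can only shrink;
-- and d_G(v,u) is still 2, because u is neither v nor a neighbour of v in G.
module Submission where

open import Defs
open import Data.Nat using (ℕ; zero; suc; _+_; _*_; _≤_; _<_; z≤n; s≤s; _<?_)
open import Data.Nat.Properties
open import Data.Nat.ListAction using (sum)
open import Data.Nat.ListAction.Properties using (sum-↭)
open import Data.Fin using (Fin)
open import Data.Fin.Properties using (punchOut-injective)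
open import Data.Bool using (Bool; true; false; if_then_else_; _∧_; T)
open import Data.Bool.Properties using (T-≡; T-∧; T-∨) renaming (_≟_ to _≟ᵇ_)
open import Data.List using (List; []; _∷_; map; allFin; filter)
open import Data.List.Properties using (length-map; map-∘)
open import Data.List.Membership.Propositional using (_∈_; lose)
open import Data.List.Membership.Propositional.Properties
  using (∈-allFin; ∈-filter⁺; ∈-filter⁻; ∈-map⁺; ∈-map⁻)
open import Data.List.Membership.Propositional.Properties.WithK using (unique∧set⇒bag)
open import Data.List.Relation.Unary.Any using (here; there; satisfied)
open import Data.List.Relation.Unary.Any.Properties using (any⁺; any⁻)
import Data.List.Relation.Unary.Unique.Propositional.Properties as Unique
open import Data.List.Relation.Binary.BagAndSetEquality using (∼bag⇒↭)
open import Data.List.Relation.Binary.Permutation.Propositional using (_↭_)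
open import Data.List.Relation.Binary.Permutation.Propositional.Properties using (↭-length; map⁺)
open import Data.Product using (∃; _×_; _,_; proj₁; proj₂)
open import Data.Sum using (inj₁; inj₂)
open import Data.Empty using (⊥-elim)
open import Relation.Nullary using (¬_; yes; no; contradiction)
open import Relation.Nullary.Decidable using (toWitness; fromWitness)
open import Relation.Binary.PropositionalEquality
  using (_≡_; _≢_; refl; trans; cong; cong₂; subst) renaming (sym to ≡-sym)
open import Function using (_∘_; _⇔_; mk⇔; Equivalence)
open import Function.Definitions using (Injective)

open Equivalence using (to; from)

≢⇒2≤ : {m : ℕ} {x y : Fin m} → x ≢ y → 2 ≤ m
≢⇒2≤ {suc (suc _)} _ = s≤s (s≤s z≤n)
≢⇒2≤ {suc zero} {Fin.zero} {Fin.zero} x≢y = contradiction refl x≢y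

distinct⇒3≤ : {m : ℕ} {x y z : Fin m} → x ≢ y → x ≢ z → y ≢ z → 3 ≤ m
distinct⇒3≤ {suc _} x≢y x≢z y≢z = s≤s (≢⇒2≤ (y≢z ∘ punchOut-injective x≢y x≢z))

sum-map-mono-≤ : {A : Set} {g h : A → ℕ} (xs : List A) → (∀ x → x ∈ xs → g x ≤ h x) →
                 sum (map g xs) ≤ sum (map h xs)
sum-map-mono-≤ []       g≤h = z≤n
sum-map-mono-≤ (x ∷ xs) g≤h = +-mono-≤ (g≤h x (here refl)) (sum-map-mono-≤ xs (λ y → g≤h y ∘ there))

sum-map-if : {A : Set} (p : A → Bool) (g : A → ℕ) (xs : List A) →
  sum (map (λ x → if p x then g x else 0) xs) ≡ sum (map g (filter (λ x → p x ≟ᵇ true) xs))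
sum-map-if p g []       = refl
sum-map-if p g (x ∷ xs) with p x
... | true  = cong (g x +_) (sum-map-if p g xs)
... | false = sum-map-if p g xs

module _ {K : Graph} where

  walk-length-≥2 : {x y : Vertex K} {j : ℕ} → x ≢ y → ¬ Adj K x y → Walk K x y j → 2 ≤ j
  walk-length-≥2 x≢y x≁y here                = contradiction refl x≢y
  walk-length-≥2 x≢y x≁y (step x~y here)     = contradiction x~y x≁y
  walk-length-≥2 x≢y x≁y (step _ (step _ _)) = s≤s (s≤s z≤n)

  Adj⇒≢ : {x y : Vertex K} → Adj K x y → x ≢ y
  Adj⇒≢ {x} x~x refl = contradiction (trans (≡-sym (irrefl K x)) x~x) λ ()

  walk⇒reachWithin : {x y : Vertex K} {k : ℕ} → Walk K x y k → T (reachWithin K k x y)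
  walk⇒reachWithin here = fromWitness refl
  walk⇒reachWithin {x} {z} (step {y = y} {k = k} x~y w) =
    from T-∨ (inj₂ (any⁺ (λ y′ → adj K x y′ ∧ reachWithin K k y′ z)
                         (lose (∈-allFin y) (from T-∧ (from T-≡ x~y , walk⇒reachWithin w)))))

  reachWithin⇒walk : (k : ℕ) {x y : Vertex K} → T (reachWithin K k x y) → ∃ λ j → j ≤ k × Walk K x y j
  reachWithin⇒walk zero r with refl ← toWitness r = 0 , z≤n , here
  reachWithin⇒walk (suc k) {x} {y} r with to T-∨ r
  ... | inj₁ r′ = let j , j≤k , w = reachWithin⇒walk k r′ in j , m≤n⇒m≤1+n j≤k , w
  ... | inj₂ r′ =
    let _ , x~z∧r = satisfied (any⁻ (λ z → adj K x z ∧ reachWithin K k z y) (allFin (n K)) r′)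
        x~z , r″ = to T-∧ x~z∧r
        j , j≤k , w = reachWithin⇒walk k r″
    in suc j , s≤s j≤k , step (to T-≡ x~z) w

  search : Vertex K → Vertex K → ℕ → ℕ → ℕ
  search x y zero    k = k
  search x y (suc f) k = if reachWithin K k x y then k else search x y f (suc k)

  search-unique : (x y : Vertex K) (h : ℕ → ℕ → ℕ) → (∀ k → h 0 k ≡ k) →
    (∀ f k → h (suc f) k ≡ (if reachWithin K k x y then k else h f (suc k))) →
    ∀ f k → h f k ≡ search x y f k
  search-unique x y h h₀ hₛ zero    k = h₀ k
  search-unique x y h h₀ hₛ (suc f) k rewrite hₛ f k with reachWithin K k x y
  ... | true  = refl
  ... | false = search-unique x y h h₀ hₛ f (suc k)

  record Ends : Set where
    constructor _⟶_
    field source target : Vertex K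

  -- The loop inside dist is local to Defs, so it is recovered as the solution
  -- of search's defining equations.  The endpoints are packed into Ends so that
  -- abstracting over n K leaves the context well typed.
  dist≡search-Ends : (e : Ends) → let open Ends e in dist K source target ≡ search source target (n K) 0
  dist≡search-Ends e =
    trans (≡-sym loop≡dist) (search-unique source target loop (λ _ → refl) (λ _ _ → refl) (n K) 0)
    where
    open Ends e
    loop : ℕ → ℕ → ℕ
    loop = _
    loop≡dist : loop (n K) 0 ≡ dist K source target
    loop≡dist with n K | 0
    ... | fuel | k = refl

  dist≡search : (x y : Vertex K) → dist K x y ≡ search x y (n K) 0
  dist≡search x y = dist≡search-Ends (x ⟶ y)

  module _ {x y : Vertex K} where

    search-finds : ∀ f k → search x y f k < k + f → T (reachWithin K (search x y f k) x y)
    search-finds zero    k s<k+0 = contradiction (subst (k <_) (+-identityʳ k) s<k+0) (n≮n k)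
    search-finds (suc f) k s<k+1+f with reachWithin K k x y in reached
    ... | true  = from T-≡ reached
    ... | false = search-finds f (suc k) (subst (search x y f (suc k) <_) (+-suc k f) s<k+1+f)

    search-≤ : ∀ f k {j} → T (reachWithin K j x y) → k ≤ j → search x y f k ≤ j
    search-≤ zero    k r k≤j = k≤j
    search-≤ (suc f) k r k≤j with reachWithin K k x y in reached
    ... | true  = k≤j
    ... | false with m≤n⇒m<n∨m≡n k≤j
    ...   | inj₁ k<j  = search-≤ f (suc k) r k<j
    ...   | inj₂ refl = ⊥-elim (subst T reached r)

    dist-≤-walk : {k : ℕ} → Walk K x y k → dist K x y ≤ k
    dist-≤-walk w rewrite dist≡search x y = search-≤ (n K) 0 (walk⇒reachWithin w) z≤n

    shortestWalk : dist K x y < n K → Walk K x y (dist K x y)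
    shortestWalk d<n =
      let j , j≤d , w = reachWithin⇒walk (dist K x y) reached
      in subst (Walk K x y) (≤-antisym j≤d (dist-≤-walk w)) w
      where
      reached : T (reachWithin K (dist K x y) x y)
      reached rewrite dist≡search x y = search-finds (n K) 0 d<n

    dist-≥ : {m : ℕ} → m ≤ n K → (∀ {j} → Walk K x y j → m ≤ j) → m ≤ dist K x y
    dist-≥ m≤n bound = ≮⇒≥ λ d<m → <⇒≱ d<m (bound (shortestWalk (<-≤-trans d<m m≤n)))

    2≤dist⇔ : 2 ≤ dist K x y ⇔ (x ≢ y × ¬ Adj K x y)
    2≤dist⇔ = mk⇔ (λ 2≤d → (λ { refl → <⇒≱ 2≤d (m≤n⇒m≤1+n (dist-≤-walk here)) })
                        , (λ x~y → <⇒≱ 2≤d (dist-≤-walk (step x~y here))))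
                 (λ (x≢y , x≁y) → dist-≥ (≢⇒2≤ x≢y) (walk-length-≥2 x≢y x≁y))

neighbours : (K : Graph) → Vertex K → List (Vertex K)
neighbours K v = filter (λ w → adj K v w ≟ᵇ true) (allFin (n K))

module _ (K : Graph) (v : Vertex K) where

  ∈-neighbours⁺ : {w : Vertex K} → Adj K v w → w ∈ neighbours K v
  ∈-neighbours⁺ {w} v~w = ∈-filter⁺ (λ w → adj K v w ≟ᵇ true) (∈-allFin w) v~w

  ∈-neighbours⁻ : {w : Vertex K} → w ∈ neighbours K v → Adj K v w
  ∈-neighbours⁻ = proj₂ ∘ ∈-filter⁻ (λ w → adj K v w ≟ᵇ true) {xs = allFin (n K)}

  nbrDistSum≡sum-neighbours : (u : Vertex K) →
                              nbrDistSum K v u ≡ sum (map (λ w → dist K w u) (neighbours K v))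
  nbrDistSum≡sum-neighbours u = sum-map-if (adj K v) (λ w → dist K w u) (allFin (n K))

  some-neighbour : 0 < deg K v → ∃ (Adj K v)
  some-neighbour 0<deg with neighbours K v in nbrs
  ... | w ∷ _ = w , ∈-neighbours⁻ (subst (w ∈_) (≡-sym nbrs) (here refl))

module Embedding (H G : Graph) (f : Vertex H → Vertex G) where

  mapWalk : (∀ a b → Adj H a b → Adj G (f a) (f b)) → {a b : Vertex H} {k : ℕ} →
            Walk H a b k → Walk G (f a) (f b) k
  mapWalk hom here         = here
  mapWalk hom (step a~b w) = step (hom _ _ a~b) (mapWalk hom w)

  -- If dist H a b is not below n H then the search defining it gave up, and any
  -- walk of length at most n H still bounds it from above.
  dist-map-≤ : (∀ a b → Adj H a b → Adj G (f a) (f b)) → {a b : Vertex H} {k : ℕ} →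
               Walk H a b k → k ≤ n H → dist G (f a) (f b) ≤ dist H a b
  dist-map-≤ hom {a} {b} w k≤n with dist H a b <? n H
  ... | yes d<n = dist-≤-walk (mapWalk hom (shortestWalk d<n))
  ... | no  d≮n = ≤-trans (dist-≤-walk (mapWalk hom w)) (≤-trans k≤n (≮⇒≥ d≮n))

  module _ (f-inj : Injective _≡_ _≡_ f) {v : Vertex H} (N≡ : SameNbhd H G f v) where

    Adj-reflect : {a : Vertex H} → Adj G (f v) (f a) → Adj H v a
    Adj-reflect fv~fa = let _ , fb≡fa , v~b = to (N≡ _) fv~fa in subst (Adj H v) (f-inj fb≡fa) v~b

    neighbours-↭ : neighbours G (f v) ↭ map f (neighbours H v)
    neighbours-↭ = ∼bag⇒↭ (unique∧set⇒bag (Unique.filter⁺ _ (Unique.allFin⁺ (n G)))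
                                          (Unique.map⁺ f-inj (Unique.filter⁺ _ (Unique.allFin⁺ (n H))))
                                          (mk⇔ toH fromH))
      where
      toH : ∀ {x} → x ∈ neighbours G (f v) → x ∈ map f (neighbours H v)
      toH m = let a , fa≡x , v~a = to (N≡ _) (∈-neighbours⁻ G (f v) m)
              in subst (_∈ _) fa≡x (∈-map⁺ f (∈-neighbours⁺ H v v~a))
      fromH : ∀ {x} → x ∈ map f (neighbours H v) → x ∈ neighbours G (f v)
      fromH m = let a , m′ , x≡fa = ∈-map⁻ f m
                in ∈-neighbours⁺ G (f v) (from (N≡ _) (a , ≡-sym x≡fa , ∈-neighbours⁻ H v m′))

    deg-≡ : deg G (f v) ≡ deg H v
    deg-≡ = trans (↭-length neighbours-↭) (length-map f (neighbours H v))

    nbrDistSum-≤ : {u : Vertex H} {y : Vertex G} → (∀ a → Adj H v a → dist G (f a) y ≤ dist H a u) →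
                   nbrDistSum G (f v) y ≤ nbrDistSum H v u
    nbrDistSum-≤ {u} {y} bound = begin
      nbrDistSum G (f v) y                           ≡⟨ nbrDistSum≡sum-neighbours G (f v) y ⟩
      sum (map distG (neighbours G (f v)))           ≡⟨ sum-↭ (map⁺ distG neighbours-↭) ⟩
      sum (map distG (map f (neighbours H v)))       ≡⟨ cong sum (≡-sym (map-∘ (neighbours H v))) ⟩
      sum (map (distG ∘ f) (neighbours H v))         ≤⟨ sum-map-mono-≤ (neighbours H v) (λ a → bound a ∘ ∈-neighbours⁻ H v) ⟩
      sum (map (λ a → dist H a u) (neighbours H v))  ≡⟨ nbrDistSum≡sum-neighbours H v u ⟨
      nbrDistSum H v u                               ∎
      where
      open ≤-Reasoning
      distG : Vertex G → ℕ
      distG x = dist G x y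

corollary3p9 : (G H : Graph) (f : Vertex H → Vertex G) → Connected G → Connected H → IsSubgraph H G f → 2 ≤ n H → (v u : Vertex H) → InBoundary H v → Witness H v u → SameNbhd H G f v → dist H v u ≡ 2 → InBoundary G (f v)
corollary3p9 G H f _ _ (injective , f-hom) _ v u _ (0<deg , sum<deg*dist) N≡ dist≡2 =
  inj₂ (f u , subst (0 <_) (≡-sym deg-G≡H) 0<deg , (begin-strict
    nbrDistSum G (f v) (f u)          ≤⟨ nbrDistSum-≤ f-inj N≡ (λ a v~a → dist-map-≤ f-hom (a⇝u v~a) 3≤n) ⟩
    nbrDistSum H v u                  <⟨ sum<deg*dist ⟩
    deg H v * dist H v u              ≡⟨ cong₂ _*_ (≡-sym deg-G≡H) dist≡2 ⟩
    deg G (f v) * 2                   ≤⟨ *-monoʳ-≤ (deg G (f v)) 2≤distG ⟩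
    deg G (f v) * dist G (f v) (f u)  ∎))
  where
  open Embedding H G f
  open ≤-Reasoning
  f-inj : Injective _≡_ _≡_ f
  f-inj = injective _ _
  deg-G≡H : deg G (f v) ≡ deg H v
  deg-G≡H = deg-≡ f-inj N≡
  v≢u×v≁u : v ≢ u × ¬ Adj H v u
  v≢u×v≁u = to 2≤dist⇔ (≤-reflexive (≡-sym dist≡2))
  v≢u : v ≢ u
  v≢u = proj₁ v≢u×v≁u
  v≁u : ¬ Adj H v u
  v≁u = proj₂ v≢u×v≁u
  2≤distG : 2 ≤ dist G (f v) (f u)
  2≤distG = from 2≤dist⇔ (v≢u ∘ f-inj , v≁u ∘ Adj-reflect f-inj N≡)
  3≤n : 3 ≤ n H
  3≤n = let _ , v~a = some-neighbour H v 0<deg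
        in distinct⇒3≤ v≢u (Adj⇒≢ {K = H} v~a) (λ { refl → v≁u v~a })
  v⇝u : Walk H v u 2
  v⇝u = subst (Walk H v u) dist≡2 (shortestWalk (subst (_< n H) (≡-sym dist≡2) 3≤n))
  a⇝u : ∀ {a} → Adj H v a → Walk H a u 3
  a⇝u {a} v~a = step (trans (Graph.sym H a v) v~a) v⇝u
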